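{- For every integer $n\geq 1$, \[ Z(n) = \sum_{i=1}^n S(n,i)\, Z_{T_0}(i), \] where $Z(n)$ is the number of topologies $\mathcal{T}$ on $\{1,\ldots,n\}$ with $\dim(\{1,\ldots,n\},\mathcal{T})=0$, $Z_{T_0}(i)$ is the number of $T_0$-topologies $\mathcal{T}$ on $\{1,\ldots,i\}$ with $\dim(\{1,\ldots,i\},\mathcal{T})=0$, and $S(n,i)$ is the Stirling number of the second kind (the number of partitions of $\{1,\ldots,n\}$ into exactly $i$ blocks).
   Context: A topology $\mathcal{T}$ on $X$ is $T_0$ if for any two distinct points $x,y$ there is an open set containing exactly one of them. A finite open covering of $(X,\mathcal{T})$ is a finite subset $\mathcal{A}\subseteq\mathcal{T}$ with $\bigcup\mathcal{A}=X$; $\mathcal{A}$ is finer than $\mathcal{B}$ if every $A\in\mathcal{A}$ is contained in some $B\in\mathcal{B}$. The order of a finite open covering $\mathcal{A}$ is the largest integer $m\geq -1$ such that $\mathcal{A}$ contains $m+1$ distinct sets with non-empty intersection. For $m\geq -1$, $\dim(X,\mathcal{T})\leq m$ means every finite open covering has a finer finite open covering of order $\leq m$; $\dim(X,\mathcal{T})=0$ means $\dim(X,\mathcal{T})\leq 0$ but not $\dim(X,\mathcal{T})\leq -1$ (the latter holds exactly for the empty space). -}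

module Defs where

open import Data.Nat using (ℕ; zero; suc; _+_; _*_)
open import Data.Bool using (Bool; true; false)
open import Data.Fin using (Fin)
open import Data.Fin.Subset using (Subset; ⊥; ⊤; _∪_; _∩_; _∈_; _∉_; _⊆_)
open import Data.Vec using (Vec; lookup)
open import Data.Product using (Σ; ∃; _×_; _,_)
open import Data.Sum using (_⊎_)
open import Relation.Binary.PropositionalEquality using (_≡_; _≢_)
open import Relation.Nullary using (¬_)
open import Data.List using (List; map; applyUpTo)
open import Data.Nat.ListAction using (sum)

Family : ℕ → Set
Family n = Subset n → Bool

_≈F_ : ∀ {n} → Family n → Family n → Set
F ≈F G = ∀ U → F U ≡ G U

-- A topology on the finite set Fin n: contains ∅ and X, closed under
-- (finite, hence all) unions and finite intersections.
IsTopology : ∀ {n} → Family n → Set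
IsTopology T =
  T ⊥ ≡ true × T ⊤ ≡ true
  × (∀ U V → T U ≡ true → T V ≡ true → T (U ∪ V) ≡ true)
  × (∀ U V → T U ≡ true → T V ≡ true → T (U ∩ V) ≡ true)

IsT0 : ∀ {n} → Family n → Set
IsT0 {n} T = ∀ (x y : Fin n) → x ≢ y →
  ∃ λ U → T U ≡ true × ((x ∈ U × y ∉ U) ⊎ (y ∈ U × x ∉ U))

IsOpenCover : ∀ {n} → Family n → Family n → Set
IsOpenCover {n} T A =
  (∀ U → A U ≡ true → T U ≡ true)
  × (∀ (x : Fin n) → ∃ λ U → A U ≡ true × x ∈ U)

Finer : ∀ {n} → Family n → Family n → Set
Finer A B = ∀ U → A U ≡ true → ∃ λ V → B V ≡ true × U ⊆ V

-- OrderLE A k  means  "order of A ≤ m" where k = m + 1 (m ≥ -1):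
-- A does not contain m+2 = suc k distinct sets with non-empty intersection.
OrderLE : ∀ {n} → Family n → ℕ → Set
OrderLE {n} A k =
  ∀ (v : Vec (Subset n) (suc k)) →
    (∀ i → A (lookup v i) ≡ true) →
    (∀ i j → lookup v i ≡ lookup v j → i ≡ j) →
    ¬ (∃ λ (x : Fin n) → ∀ i → x ∈ lookup v i)

-- DimLE T k  means  dim(X, T) ≤ m  where k = m + 1 (m ≥ -1).
DimLE : ∀ {n} → Family n → ℕ → Set
DimLE {n} T k = ∀ (A : Family n) → IsOpenCover T A →
  ∃ λ (B : Family n) → IsOpenCover T B × Finer B A × OrderLE B k

-- dim(X, T) = 0 : dim ≤ 0 but not dim ≤ -1
Dim0 : ∀ {n} → Family n → Set
Dim0 T = DimLE T 1 × ¬ DimLE T 0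

ZeroDimTop : (n : ℕ) → Family n → Set
ZeroDimTop n T = IsTopology {n} T × Dim0 T

ZeroDimT0Top : (n : ℕ) → Family n → Set
ZeroDimT0Top n T = IsTopology {n} T × IsT0 T × Dim0 T

-- HasCard n P k : the families (up to extensional equality) satisfying P
-- are exactly k in number: a duplicate-free complete list of length k.
HasCard : (n : ℕ) → (Family n → Set) → ℕ → Set
HasCard n P k = Σ (Vec (Family n) k) λ v →
  (∀ i → P (lookup v i))
  × (∀ i j → lookup v i ≈F lookup v j → i ≡ j)
  × (∀ F → P F → ∃ λ i → F ≈F lookup v i)

S : ℕ → ℕ → ℕ
S zero zero = 1
S zero (suc k) = 0
S (suc n) zero = 0
S (suc n) (suc k) = suc k * S n (suc k) + S n k

sum1to : ℕ → (ℕ → ℕ) → ℕ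
sum1to n f = sum (map f (applyUpTo suc n))

-- In a topology T on Fin n call x, y indistinguishable when no open set
-- separates them; this is a decidable equivalence relation.  Its classes form a
-- partition of Fin n, encoded canonically by a restricted growth string r with
-- k blocks and block map f = blockOf r : Fin n → Fin k, and T consists exactly of
-- the preimages f⁻¹W of the opens W of a T₀ topology on Fin k (the Kolmogorov
-- quotient).  Conversely, for every r and every T₀ topology T′ on Fin k, f⁻¹T′
-- is a topology whose indistinguishability classes are the blocks of r.  Since
-- f⁻¹ is an injective lattice map on subsets, open covers, refinement and order
-- of covers correspond along f, so f⁻¹T′ is zero-dimensional iff T′ is.  Thus
-- (r , T′) ↦ f⁻¹T′ is a bijection from Σ_{k=1}^{n} (partitions into k blocks) ×
-- (zero-dimensional T₀ topologies on Fin k) onto the zero-dimensional topologies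
-- on Fin n, and there are S(n,k) partitions into k blocks.

module Submission where

open import Defs
open import Data.Nat using (ℕ; _≥_; _*_)
open import Relation.Binary.PropositionalEquality using (_≡_)

open import Data.Nat using (zero; suc; _+_; _≤_; z≤n; s≤s)
open import Data.Nat.Properties using (m≤n⇒m≤1+n; ≤-antisym)
import Data.Nat.Properties as ℕ
open import Data.Bool as Bool using (Bool; true; false; _∧_; _∨_)
open import Data.Fin using (Fin; zero; suc; toℕ; fromℕ<; _≟_)
open import Data.Fin.Properties
  using (any?; toℕ-injective; toℕ-fromℕ<; injective⇒≤; 0≢1+n; suc-injective; +↔⊎; *↔×)
open import Data.Fin.Subset using (Subset; _∈_; _∉_; _⊆_)
import Data.Fin.Subset as Subset
open import Data.Vec as Vec using (Vec; lookup; tabulate; replicate; zipWith; []; _∷_)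
open import Data.Vec.Properties
  using ([]=⇒lookup; lookup⇒[]=; tabulate∘lookup; lookup∘tabulate; tabulate-cong;
         lookup-replicate; lookup-zipWith; lookup-map; ≡-dec)
open import Data.Vec.Functional using (foldr)
open import Data.Product using (Σ; ∃; _×_; _,_; proj₁; proj₂)
open import Data.Sum using (_⊎_; inj₁; inj₂; [_,_]′)
open import Data.Sum.Function.Propositional using (_⊎-↔_)
open import Data.Product.Function.NonDependent.Propositional using (_×-↔_)
open import Data.Empty using (⊥-elim)
open import Data.List using (map; applyUpTo)
open import Data.Nat.ListAction using (sum)
open import Function using (_∘_)
open import Function.Bundles using (_↔_; Inverse; mk↔ₛ′)
open import Function.Properties.Inverse using (↔-refl; ↔-trans)
open import Relation.Nullary using (¬_; Dec; yes; no; does)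
open import Relation.Nullary.Decidable using (_×-dec_; _⊎-dec_; ¬?; map′; decidable-stable; dec-true)
open import Relation.Binary.Definitions using (DecidableEquality)
open import Relation.Binary.Structures using (IsDecEquivalence)
open import Relation.Binary.PropositionalEquality
  using (_≢_; refl; sym; trans; cong; cong₂; subst; module ≡-Reasoning)

bool-ext : ∀ {a b : Bool} → (a ≡ true → b ≡ true) → (b ≡ true → a ≡ true) → a ≡ b
bool-ext {true}  {true}  _ _ = refl
bool-ext {true}  {false} f _ = sym (f refl)
bool-ext {false} {true}  _ g = g refl
bool-ext {false} {false} _ _ = refl

witness : ∀ {A : Set} (a? : Dec A) → does a? ≡ true → A
witness (yes a) _ = a

≡⇒≈F : ∀ {n} {F G : Family n} → F ≡ G → F ≈F G
≡⇒≈F refl _ = refl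

≈F-sym : ∀ {n} {F G : Family n} → F ≈F G → G ≈F F
≈F-sym e U = sym (e U)

≈F-trans : ∀ {n} {F G H : Family n} → F ≈F G → G ≈F H → F ≈F H
≈F-trans e e′ U = trans (e U) (e′ U)

∈⇒true : ∀ {n} {x : Fin n} {U : Subset n} → x ∈ U → lookup U x ≡ true
∈⇒true = []=⇒lookup

true⇒∈ : ∀ {n} {x : Fin n} {U : Subset n} → lookup U x ≡ true → x ∈ U
true⇒∈ {x = x} {U} = lookup⇒[]= x U

false⇒∉ : ∀ {n} {x : Fin n} {U : Subset n} → lookup U x ≡ false → x ∉ U
false⇒∉ x↦false x∈U with trans (sym x↦false) (∈⇒true x∈U)
... | ()

∈-separation : ∀ {n} (U : Subset n) {x y} → lookup U x ≢ lookup U y →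
  (x ∈ U × y ∉ U) ⊎ (y ∈ U × x ∉ U)
∈-separation U {x} {y} differ with lookup U x in ex | lookup U y in ey
... | true  | true  = ⊥-elim (differ refl)
... | true  | false = inj₁ (true⇒∈ ex , false⇒∉ ey)
... | false | true  = inj₂ (true⇒∈ ey , false⇒∉ ex)
... | false | false = ⊥-elim (differ refl)

subset-ext : ∀ {n} {U V : Subset n} → (∀ x → lookup U x ≡ lookup V x) → U ≡ V
subset-ext {U = U} {V} same = begin
  U                    ≡⟨ sym (tabulate∘lookup U) ⟩
  tabulate (lookup U)  ≡⟨ tabulate-cong same ⟩
  tabulate (lookup V)  ≡⟨ tabulate∘lookup V ⟩
  V                    ∎
  where open ≡-Reasoning

_≟ₛ_ : ∀ {n} → DecidableEquality (Subset n)
_≟ₛ_ = ≡-dec Bool._≟_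

-- There are finitely many subsets, so existence of a subset with a decidable
-- property is decidable; this makes pulled-back families computable.
∃-subset? : ∀ {n} {P : Subset n → Set} → (∀ U → Dec (P U)) → Dec (∃ P)
∃-subset? {zero} P? = map′ ([] ,_) (λ { ([] , p) → p }) (P? [])
∃-subset? {suc n} {P} P? =
  map′ [ (λ (U , p) → true ∷ U , p) , (λ (U , p) → false ∷ U , p) ]′ byHead
       (∃-subset? (P? ∘ (true ∷_)) ⊎-dec ∃-subset? (P? ∘ (false ∷_)))
  where
  byHead : ∃ P → ∃ (P ∘ (true ∷_)) ⊎ ∃ (P ∘ (false ∷_))
  byHead (true ∷ U , p)  = inj₁ (U , p)
  byHead (false ∷ U , p) = inj₂ (U , p)

Onto : ∀ {n k} → (Fin n → Fin k) → Set
Onto f = ∀ j → ∃ λ x → f x ≡ j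

module _ {n k : ℕ} (f : Fin n → Fin k) where

  preimage : Subset k → Subset n
  preimage V = tabulate (lookup V ∘ f)

  lookup-preimage : ∀ V x → lookup (preimage V) x ≡ lookup V (f x)
  lookup-preimage V = lookup∘tabulate (lookup V ∘ f)

  ∈-preimage : ∀ {V x} → f x ∈ V → x ∈ preimage V
  ∈-preimage {V} {x} p = true⇒∈ (trans (lookup-preimage V x) (∈⇒true p))

  preimage-∈ : ∀ {V x} → x ∈ preimage V → f x ∈ V
  preimage-∈ {V} {x} p = true⇒∈ (trans (sym (lookup-preimage V x)) (∈⇒true p))

  preimage-⊆ : ∀ {V W} → V ⊆ W → preimage V ⊆ preimage W
  preimage-⊆ V⊆W = ∈-preimage ∘ V⊆W ∘ preimage-∈

  preimage-replicate : ∀ b → preimage (replicate k b) ≡ replicate n b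
  preimage-replicate b = subset-ext λ x →
    trans (lookup-preimage (replicate k b) x) (trans (lookup-replicate (f x) b) (sym (lookup-replicate x b)))

  preimage-zipWith : ∀ (_·_ : Bool → Bool → Bool) V W →
    preimage (zipWith _·_ V W) ≡ zipWith _·_ (preimage V) (preimage W)
  preimage-zipWith _·_ V W = subset-ext λ x → begin
    lookup (preimage (zipWith _·_ V W)) x                 ≡⟨ lookup-preimage (zipWith _·_ V W) x ⟩
    lookup (zipWith _·_ V W) (f x)                         ≡⟨ lookup-zipWith _·_ (f x) V W ⟩
    lookup V (f x) · lookup W (f x)                        ≡˘⟨ cong₂ _·_ (lookup-preimage V x) (lookup-preimage W x) ⟩
    lookup (preimage V) x · lookup (preimage W) x          ≡˘⟨ lookup-zipWith _·_ x (preimage V) (preimage W) ⟩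
    lookup (zipWith _·_ (preimage V) (preimage W)) x       ∎
    where open ≡-Reasoning

  module _ (onto : Onto f) where

    preimage-injective : ∀ {V W} → preimage V ≡ preimage W → V ≡ W
    preimage-injective {V} {W} e = subset-ext λ j → let (x , fx≡j) = onto j in begin
      lookup V j              ≡˘⟨ cong (lookup V) fx≡j ⟩
      lookup V (f x)          ≡˘⟨ lookup-preimage V x ⟩
      lookup (preimage V) x   ≡⟨ cong (λ U → lookup U x) e ⟩
      lookup (preimage W) x   ≡⟨ lookup-preimage W x ⟩
      lookup W (f x)          ≡⟨ cong (lookup W) fx≡j ⟩
      lookup W j              ∎
      where open ≡-Reasoning

    preimage-⊆-reflect : ∀ {V W} → preimage V ⊆ preimage W → V ⊆ W
    preimage-⊆-reflect sub {j} j∈V with onto j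
    ... | x , refl = preimage-∈ (sub (∈-preimage j∈V))

  pull : Family k → Family n
  pull X U = does (∃-subset? λ W → (X W Bool.≟ true) ×-dec (U ≟ₛ preimage W))

  pull-member : ∀ {X U} → pull X U ≡ true → ∃ λ W → X W ≡ true × U ≡ preimage W
  pull-member = witness (∃-subset? _)

  member-pull : ∀ {X} W → X W ≡ true → pull X (preimage W) ≡ true
  member-pull W XW = dec-true (∃-subset? _) (W , XW , refl)

  pull-cong : ∀ {X Y} → X ≈F Y → pull X ≈F pull Y
  pull-cong {X} {Y} X≈Y U = bool-ext (transport X≈Y) (transport (≈F-sym X≈Y))
    where
    transport : ∀ {X Y} → X ≈F Y → pull X U ≡ true → pull Y U ≡ true
    transport X≈Y p with pull-member p
    ... | W , XW , refl = member-pull W (trans (sym (X≈Y W)) XW)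

-- Induced topologies and the transfer of dimension

record Induced {n k} (f : Fin n → Fin k) (T : Family n) (T′ : Family k) : Set where
  field
    member⇒preimage : ∀ U → T U ≡ true → ∃ λ W → T′ W ≡ true × U ≡ preimage f W
    preimage-member : ∀ W → T′ W ≡ true → T (preimage f W) ≡ true

pull-induced : ∀ {n k} (f : Fin n → Fin k) (X : Family k) → Induced f (pull f X) X
pull-induced f X = record { member⇒preimage = λ U → pull-member f
                          ; preimage-member = member-pull f }

induced≈pull : ∀ {n k} {f : Fin n → Fin k} {T T′} → Induced f T T′ → T ≈F pull f T′
induced≈pull {f = f} {T} {T′} I U = bool-ext to from
  where
  open Induced I
  to : T U ≡ true → pull f T′ U ≡ true
  to p with member⇒preimage U p
  ... | W , T′W , refl = member-pull f W T′W
  from : pull f T′ U ≡ true → T U ≡ true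
  from p with pull-member f p
  ... | W , T′W , refl = preimage-member W T′W

push : ∀ {n k} → (Fin n → Fin k) → Family n → Family k
push f A V = A (preimage f V)

finer-pull : ∀ {n k} (f : Fin n → Fin k) {A : Family n} {B′ : Family k} →
  Finer B′ (push f A) → Finer (pull f B′) A
finer-pull f fin U p with pull-member f p
... | W , B′W , refl with fin W B′W
...   | V , AV , W⊆V = preimage f V , AV , preimage-⊆ f W⊆V

module Transfer {n k} {f : Fin n → Fin k} (onto : Onto f)
                {T : Family n} {T′ : Family k} (I : Induced f T T′) where
  open Induced I

  member-reflect : ∀ V → T (preimage f V) ≡ true → T′ V ≡ true
  member-reflect V p with member⇒preimage _ p
  ... | W , T′W , e = subst (λ Z → T′ Z ≡ true) (sym (preimage-injective f onto e)) T′W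

  topology-up : IsTopology T′ → IsTopology T
  topology-up (∅ , X , ∪-closed , ∩-closed) =
    subst (λ Z → T Z ≡ true) (preimage-replicate f false) (preimage-member _ ∅) ,
    subst (λ Z → T Z ≡ true) (preimage-replicate f true) (preimage-member _ X) ,
    closed Subset._∪_ (preimage-zipWith f _∨_) ∪-closed ,
    closed Subset._∩_ (preimage-zipWith f _∧_) ∩-closed
    where
    closed : ∀ (_·_ : ∀ {m} → Subset m → Subset m → Subset m) →
      (∀ V W → preimage f (V · W) ≡ preimage f V · preimage f W) →
      (∀ V W → T′ V ≡ true → T′ W ≡ true → T′ (V · W) ≡ true) →
      ∀ U U′ → T U ≡ true → T U′ ≡ true → T (U · U′) ≡ true
    closed _·_ hom closed′ U U′ p q with member⇒preimage U p | member⇒preimage U′ q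
    ... | V , T′V , refl | W , T′W , refl =
      subst (λ Z → T Z ≡ true) (hom V W) (preimage-member _ (closed′ V W T′V T′W))

  topology-down : IsTopology T → IsTopology T′
  topology-down (∅ , X , ∪-closed , ∩-closed) =
    member-reflect _ (subst (λ Z → T Z ≡ true) (sym (preimage-replicate f false)) ∅) ,
    member-reflect _ (subst (λ Z → T Z ≡ true) (sym (preimage-replicate f true)) X) ,
    (λ V W p q → member-reflect _ (subst (λ Z → T Z ≡ true) (sym (preimage-zipWith f _∨_ V W))
                   (∪-closed _ _ (preimage-member V p) (preimage-member W q)))) ,
    (λ V W p q → member-reflect _ (subst (λ Z → T Z ≡ true) (sym (preimage-zipWith f _∧_ V W))
                   (∩-closed _ _ (preimage-member V p) (preimage-member W q))))

  cover-pull : ∀ {A′} → IsOpenCover T′ A′ → IsOpenCover T (pull f A′)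
  cover-pull {A′} (open′ , covers′) = opens , covers
    where
    opens : ∀ U → pull f A′ U ≡ true → T U ≡ true
    opens U p with pull-member f p
    ... | W , A′W , refl = preimage-member W (open′ W A′W)
    covers : ∀ x → ∃ λ U → pull f A′ U ≡ true × x ∈ U
    covers x with covers′ (f x)
    ... | W , A′W , fx∈W = preimage f W , member-pull f W A′W , ∈-preimage f fx∈W

  cover-push : ∀ {A} → IsOpenCover T A → IsOpenCover T′ (push f A)
  cover-push {A} (opens , covers) = (λ V p → member-reflect V (opens _ p)) , covers′
    where
    covers′ : ∀ j → ∃ λ V → push f A V ≡ true × j ∈ V
    covers′ j with onto j
    ... | x , refl with covers x
    ...   | U , AU , x∈U with member⇒preimage U (opens U AU)
    ...     | W , _ , refl = W , AU , preimage-∈ f x∈U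

  finer-push : ∀ {A′ B} → Finer B (pull f A′) → Finer (push f B) A′
  finer-push fin V BV with fin _ BV
  ... | U , A′U , sub with pull-member f A′U
  ...   | W , A′W , refl = W , A′W , preimage-⊆-reflect f onto sub

  order-pull : ∀ {B′ d} → OrderLE B′ d → OrderLE (pull f B′) d
  order-pull {B′} {d} order′ v inB distinct (x , common) =
    order′ w inB′ distinct′ (f x , common′)
    where
    chosen : ∀ i → ∃ λ W → B′ W ≡ true × lookup v i ≡ preimage f W
    chosen i = pull-member f (inB i)
    w : Vec (Subset k) (suc d)
    w = tabulate (proj₁ ∘ chosen)
    lookup-w : ∀ i → lookup w i ≡ proj₁ (chosen i)
    lookup-w = lookup∘tabulate (proj₁ ∘ chosen)
    lookup-v : ∀ i → lookup v i ≡ preimage f (lookup w i)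
    lookup-v i = trans (proj₂ (proj₂ (chosen i))) (cong (preimage f) (sym (lookup-w i)))
    inB′ : ∀ i → B′ (lookup w i) ≡ true
    inB′ i = subst (λ Z → B′ Z ≡ true) (sym (lookup-w i)) (proj₁ (proj₂ (chosen i)))
    distinct′ : ∀ i j → lookup w i ≡ lookup w j → i ≡ j
    distinct′ i j e = distinct i j (trans (lookup-v i) (trans (cong (preimage f) e) (sym (lookup-v j))))
    common′ : ∀ i → f x ∈ lookup w i
    common′ i = preimage-∈ f (subst (x ∈_) (lookup-v i) (common i))

  order-push : ∀ {B d} → OrderLE B d → OrderLE (push f B) d
  order-push {B} {d} order v′ inB′ distinct′ (j , common′) with onto j
  ... | x , refl = order v inB distinct (x , common)
    where
    v : Vec (Subset n) (suc d)
    v = Vec.map (preimage f) v′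
    lookup-v : ∀ i → lookup v i ≡ preimage f (lookup v′ i)
    lookup-v i = lookup-map i (preimage f) v′
    inB : ∀ i → B (lookup v i) ≡ true
    inB i = subst (λ Z → B Z ≡ true) (sym (lookup-v i)) (inB′ i)
    distinct : ∀ i i′ → lookup v i ≡ lookup v i′ → i ≡ i′
    distinct i i′ e = distinct′ i i′
      (preimage-injective f onto (trans (sym (lookup-v i)) (trans e (lookup-v i′))))
    common : ∀ i → x ∈ lookup v i
    common i = subst (x ∈_) (sym (lookup-v i)) (∈-preimage f (common′ i))

  dim-up : ∀ {d} → DimLE T′ d → DimLE T d
  dim-up D A cover with D (push f A) (cover-push cover)
  ... | B′ , cover′ , fin′ , order′ =
    pull f B′ , cover-pull cover′ , finer-pull f fin′ , order-pull order′

  dim-down : ∀ {d} → DimLE T d → DimLE T′ d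
  dim-down D A′ cover′ with D (pull f A′) (cover-pull cover′)
  ... | B , cover , fin , order = push f B , cover-push cover , finer-push fin , order-push {B} order

  dim0-up : Dim0 T′ → Dim0 T
  dim0-up (≤0 , ≰-1) = dim-up ≤0 , ≰-1 ∘ dim-down

  dim0-down : Dim0 T → Dim0 T′
  dim0-down (≤0 , ≰-1) = dim-down ≤0 , ≰-1 ∘ dim-up

pull-injective : ∀ {n k} {f : Fin n → Fin k} → Onto f → ∀ {X Y} → pull f X ≈F pull f Y → X ≈F Y
pull-injective {f = f} onto {X} {Y} e V = bool-ext
  (λ XV → Transfer.member-reflect onto (pull-induced f Y) V (trans (sym (e _)) (member-pull f V XV)))
  (λ YV → Transfer.member-reflect onto (pull-induced f X) V (trans (e _) (member-pull f V YV)))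

-- Indistinguishability and Kolmogorov quotients

Indist : ∀ {n} → Family n → Fin n → Fin n → Set
Indist T x y = ¬ (∃ λ U → T U ≡ true × lookup U x ≢ lookup U y)

separation? : ∀ {n} (T : Family n) x y → Dec (∃ λ U → T U ≡ true × lookup U x ≢ lookup U y)
separation? T x y = ∃-subset? λ U → (T U Bool.≟ true) ×-dec ¬? (lookup U x Bool.≟ lookup U y)

indist-same : ∀ {n} {T : Family n} {x y} → Indist T x y → ∀ U → T U ≡ true → lookup U x ≡ lookup U y
indist-same {x = x} {y} ind U TU with lookup U x Bool.≟ lookup U y
... | yes e = e
... | no ne = ⊥-elim (ind (U , TU , ne))

indist-cong : ∀ {n} {T T′ : Family n} → T ≈F T′ → ∀ {x y} → Indist T x y → Indist T′ x y
indist-cong T≈T′ ind (U , T′U , ne) = ind (U , trans (T≈T′ U) T′U , ne)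

indist-isDecEquivalence : ∀ {n} (T : Family n) → IsDecEquivalence (Indist T)
indist-isDecEquivalence T = record
  { isEquivalence = record
    { refl  = λ (U , _ , ne) → ne refl
    ; sym   = λ ind (U , TU , ne) → ind (U , TU , ne ∘ sym)
    ; trans = λ ind ind′ (U , TU , ne) → ne (trans (indist-same ind U TU) (indist-same ind′ U TU)) }
  ; _≟_ = λ x y → ¬? (separation? T x y) }

HasKernel : ∀ {n} {A : Set} → (Fin n → A) → (Fin n → Fin n → Set) → Set
HasKernel f R = ∀ x y → (f x ≡ f y → R x y) × (R x y → f x ≡ f y)

induced-kernel : ∀ {n k} {f : Fin n → Fin k} {T T′} → Induced f T T′ → IsT0 T′ → HasKernel f (Indist T)
induced-kernel {f = f} {T} {T′} I t0 x y = identify , separate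
  where
  open Induced I
  identify : f x ≡ f y → Indist T x y
  identify fx≡fy (U , TU , ne) with member⇒preimage U TU
  ... | W , _ , refl =
    ne (trans (lookup-preimage f W x) (trans (cong (lookup W) fx≡fy) (sym (lookup-preimage f W y))))
  separates : ∀ {W} → (f x ∈ W × f y ∉ W) ⊎ (f y ∈ W × f x ∉ W) → lookup W (f x) ≢ lookup W (f y)
  separates (inj₁ (in₁ , out₂)) e = out₂ (true⇒∈ (trans (sym e) (∈⇒true in₁)))
  separates (inj₂ (in₂ , out₁)) e = out₁ (true⇒∈ (trans e (∈⇒true in₂)))
  separate : Indist T x y → f x ≡ f y
  separate ind with f x ≟ f y
  ... | yes e = e
  ... | no ne with t0 (f x) (f y) ne
  ...   | W , T′W , sep = ⊥-elim (ind (preimage f W , preimage-member W T′W , λ e →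
            separates sep (trans (sym (lookup-preimage f W x)) (trans e (lookup-preimage f W y)))))

module Quotient {n k} {f : Fin n → Fin k} (onto : Onto f)
                {T : Family n} (kernel : HasKernel f (Indist T)) where

  section : Fin k → Fin n
  section j = proj₁ (onto j)

  section-fibre : ∀ j → f (section j) ≡ j
  section-fibre j = proj₂ (onto j)

  -- T is induced from its quotient by the indistinguishability relation:
  -- every open set is saturated, hence the preimage of its image.
  quotient-induced : Induced f T (push f T)
  quotient-induced = record { member⇒preimage = saturated ; preimage-member = λ W p → p }
    where
    saturated : ∀ U → T U ≡ true → ∃ λ W → push f T W ≡ true × U ≡ preimage f W
    saturated U TU = W , subst (λ Z → T Z ≡ true) U≡f⁻¹W TU , U≡f⁻¹W
      where
      W : Subset k
      W = tabulate (lookup U ∘ section)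
      U≡f⁻¹W : U ≡ preimage f W
      U≡f⁻¹W = subset-ext λ x → sym (begin
        lookup (preimage f W) x      ≡⟨ lookup-preimage f W x ⟩
        lookup W (f x)               ≡⟨ lookup∘tabulate (lookup U ∘ section) (f x) ⟩
        lookup U (section (f x))     ≡⟨ indist-same (proj₁ (kernel _ x) (section-fibre (f x))) U TU ⟩
        lookup U x                   ∎)
        where open ≡-Reasoning

  separating-open : ∀ {j j′} → j ≢ j′ →
    ∃ λ U → T U ≡ true × lookup U (section j) ≢ lookup U (section j′)
  separating-open {j} {j′} j≢j′ =
    decidable-stable (separation? T (section j) (section j′)) distinguishable
    where
    distinguishable : ¬ Indist T (section j) (section j′)
    distinguishable ind = j≢j′ (begin
      j                  ≡˘⟨ section-fibre j ⟩
      f (section j)      ≡⟨ proj₂ (kernel _ _) ind ⟩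
      f (section j′)     ≡⟨ section-fibre j′ ⟩
      j′                 ∎)
      where open ≡-Reasoning

  quotient-T0 : IsT0 (push f T)
  quotient-T0 j j′ j≢j′ with separating-open j≢j′
  ... | U , TU , U-separates with Induced.member⇒preimage quotient-induced U TU
  ...   | W , T′W , refl = W , T′W , ∈-separation W W-separates
    where
    W-separates : lookup W j ≢ lookup W j′
    W-separates e = U-separates (begin
      lookup (preimage f W) (section j)    ≡⟨ lookup-preimage f W _ ⟩
      lookup W (f (section j))             ≡⟨ cong (lookup W) (section-fibre j) ⟩
      lookup W j                           ≡⟨ e ⟩
      lookup W j′                          ≡˘⟨ cong (lookup W) (section-fibre j′) ⟩
      lookup W (f (section j′))            ≡˘⟨ lookup-preimage f W _ ⟩
      lookup (preimage f W) (section j′)   ∎)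
      where open ≡-Reasoning

-- Partitions as restricted growth strings

-- RGS n k : partitions of Fin n into k blocks, built point by point; each new
-- point joins an old block or opens the next block.  Blocks are numbered in
-- order of first appearance, so the encoding is canonical.
data RGS : ℕ → ℕ → Set where
  nil : RGS 0 0
  old : ∀ {n k} → RGS n k → Fin k → RGS (suc n) k
  new : ∀ {n k} → RGS n k → RGS (suc n) (suc k)

blockOf : ∀ {n k} → RGS n k → Fin n → Fin k
blockOf (old r j) zero    = j
blockOf (old r j) (suc x) = blockOf r x
blockOf (new r)   zero    = zero
blockOf (new r)   (suc x) = suc (blockOf r x)

blockOf-onto : ∀ {n k} (r : RGS n k) → Onto (blockOf r)
blockOf-onto (old r j) j′ = let (x , e) = blockOf-onto r j′ in suc x , e
blockOf-onto (new r) zero = zero , refl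
blockOf-onto (new r) (suc j) = let (x , e) = blockOf-onto r j in suc x , cong suc e

blocks≤ : ∀ {n k} → RGS n k → k ≤ n
blocks≤ nil       = z≤n
blocks≤ (old r _) = m≤n⇒m≤1+n (blocks≤ r)
blocks≤ (new r)   = s≤s (blocks≤ r)

blocks≥1 : ∀ {n k} → Fin n → RGS n k → 1 ≤ k
blocks≥1 {k = zero} x r with blockOf r x
... | ()
blocks≥1 {k = suc k} _ _ = s≤s z≤n

rgs-unique : ∀ {n k k′} (r : RGS n k) (r′ : RGS n k′) →
  HasKernel (blockOf r) (λ x y → blockOf r′ x ≡ blockOf r′ y) →
  _≡_ {A = Σ ℕ (RGS n)} (k , r) (k′ , r′)
rgs-unique nil nil K = refl
rgs-unique (old r j) (old r′ j′) K with rgs-unique r r′ (λ x y → K (suc x) (suc y))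
... | refl = let (x , e) = blockOf-onto r j in
  cong (λ i → _ , old r i) (trans (sym e) (sym (proj₁ (K zero (suc x)) (sym e))))
rgs-unique (old r j) (new r′) K =
  let (x , e) = blockOf-onto r j in ⊥-elim (0≢1+n (proj₁ (K zero (suc x)) (sym e)))
rgs-unique (new r) (old r′ j′) K =
  let (x , e) = blockOf-onto r′ j′ in ⊥-elim (0≢1+n (proj₂ (K zero (suc x)) (sym e)))
rgs-unique (new r) (new r′) K with rgs-unique r r′ (λ x y →
    (λ e → suc-injective (proj₁ (K (suc x) (suc y)) (cong suc e))) ,
    (λ e → suc-injective (proj₂ (K (suc x) (suc y)) (cong suc e))))
... | refl = refl

restrict : ∀ {n} {R : Fin (suc n) → Fin (suc n) → Set} → IsDecEquivalence R →
  IsDecEquivalence (λ x y → R (suc x) (suc y))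
restrict isDecEq = record
  { isEquivalence = record { refl = R-refl ; sym = R-sym ; trans = R-trans }
  ; _≟_ = λ x y → R? (suc x) (suc y) }
  where open IsDecEquivalence isDecEq renaming (refl to R-refl; sym to R-sym; trans to R-trans; _≟_ to R?)

-- Every decidable equivalence relation on Fin n is the kernel of a partition:
-- point 0 joins the block of some related later point, or opens a new block.
rgs-exists : ∀ {n} {R : Fin n → Fin n → Set} → IsDecEquivalence R →
  ∃ λ k → Σ (RGS n k) λ r → HasKernel (blockOf r) R
rgs-exists {zero} _ = 0 , nil , λ ()
rgs-exists {suc n} {R} isDecEq
  with rgs-exists (restrict isDecEq) | any? (λ x → IsDecEquivalence._≟_ isDecEq zero (suc x))
... | k , r , K | yes (x₀ , R0x₀) = k , old r (blockOf r x₀) , K′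
  where
  open IsDecEquivalence isDecEq renaming (refl to R-refl; sym to R-sym; trans to R-trans)
  K′ : HasKernel (blockOf (old r (blockOf r x₀))) R
  K′ zero    zero    = (λ _ → R-refl) , (λ _ → refl)
  K′ zero    (suc y) = (λ e → R-trans R0x₀ (proj₁ (K x₀ y) e)) ,
                       (λ q → proj₂ (K x₀ y) (R-trans (R-sym R0x₀) q))
  K′ (suc y) zero    = (λ e → R-sym (R-trans R0x₀ (proj₁ (K x₀ y) (sym e)))) ,
                       (λ q → sym (proj₂ (K x₀ y) (R-trans (R-sym R0x₀) (R-sym q))))
  K′ (suc x) (suc y) = K x y
... | k , r , K | no unrelated = suc k , new r , K′
  where
  open IsDecEquivalence isDecEq renaming (refl to R-refl; sym to R-sym)
  K′ : HasKernel (blockOf (new r)) R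
  K′ zero    zero    = (λ _ → R-refl) , (λ _ → refl)
  K′ zero    (suc y) = (λ ()) , (λ q → ⊥-elim (unrelated (y , q)))
  K′ (suc y) zero    = (λ ()) , (λ q → ⊥-elim (unrelated (y , R-sym q)))
  K′ (suc x) (suc y) = (λ e → proj₁ (K x y) (suc-injective e)) , (λ q → cong suc (proj₂ (K x y) q))

-- Counting by explicit enumerations

-- There are S(n,k) partitions of Fin n into k blocks, by the recurrence
-- S(n+1,k+1) = (k+1) S(n,k+1) + S(n,k): the outermost step is old or new.
enum-RGS : ∀ n k → Fin (S n k) ↔ RGS n k
enum-RGS zero    zero    = mk↔ₛ′ (λ _ → nil) (λ _ → zero) (λ { nil → refl }) (λ { zero → refl })
enum-RGS zero    (suc k) = mk↔ₛ′ (λ ()) (λ ()) (λ ()) (λ ())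
enum-RGS (suc n) zero    = mk↔ₛ′ (λ ()) (λ { (old r ()) }) (λ { (old r ()) }) (λ ())
enum-RGS (suc n) (suc k) =
  ↔-trans +↔⊎ (↔-trans ((↔-trans *↔× (↔-refl ×-↔ enum-RGS n (suc k))) ⊎-↔ enum-RGS n k) lastStep)
  where
  lastStep : ((Fin (suc k) × RGS n (suc k)) ⊎ RGS n k) ↔ RGS (suc n) (suc k)
  lastStep = mk↔ₛ′ [ (λ (j , r) → old r j) , new ]′ (λ { (old r j) → inj₁ (j , r) ; (new r) → inj₂ r })
                   (λ { (old r j) → refl ; (new r) → refl }) (λ { (inj₁ _) → refl ; (inj₂ _) → refl })

enum-Σ : ∀ {n} {Z : Fin n → Set} (c : Fin n → ℕ) → (∀ j → Fin (c j) ↔ Z j) →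
  Fin (foldr _+_ 0 c) ↔ Σ (Fin n) Z
enum-Σ {zero}  c E = mk↔ₛ′ (λ ()) (λ { (() , _) }) (λ { (() , _) }) (λ ())
enum-Σ {suc n} {Z} c E = ↔-trans +↔⊎ (↔-trans (E zero ⊎-↔ enum-Σ (c ∘ suc) (E ∘ suc)) firstOrRest)
  where
  firstOrRest : (Z zero ⊎ Σ (Fin n) (Z ∘ suc)) ↔ Σ (Fin (suc n)) Z
  firstOrRest = mk↔ₛ′ [ (zero ,_) , (λ (j , z) → suc j , z) ]′
                      (λ { (zero , z) → inj₁ z ; (suc j , z) → inj₂ (j , z) })
                      (λ { (zero , _) → refl ; (suc _ , _) → refl })
                      (λ { (inj₁ _) → refl ; (inj₂ _) → refl })

sum-applyUpTo : ∀ n (g h : ℕ → ℕ) →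
  sum (map h (applyUpTo g n)) ≡ foldr _+_ 0 (λ (j : Fin n) → h (g (toℕ j)))
sum-applyUpTo zero    g h = refl
sum-applyUpTo (suc n) g h = cong (h (g 0) +_) (sum-applyUpTo n (g ∘ suc) h)

hasCard-≤ : ∀ {n P a b} → HasCard n P a → HasCard n P b → a ≤ b
hasCard-≤ (v , sound , distinct , _) (v′ , _ , _ , complete′) = injective⇒≤ {f = position} injective
  where
  position : Fin _ → Fin _
  position i = proj₁ (complete′ (lookup v i) (sound i))
  injective : ∀ {i j} → position i ≡ position j → i ≡ j
  injective {i} {j} e = distinct i j
    (≈F-trans (proj₂ (complete′ (lookup v i) (sound i)))
    (≈F-trans (≡⇒≈F (cong (lookup v′) e)) (≈F-sym (proj₂ (complete′ (lookup v j) (sound j))))))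

hasCard-unique : ∀ {n P a b} → HasCard n P a → HasCard n P b → a ≡ b
hasCard-unique h h′ = ≤-antisym (hasCard-≤ h h′) (hasCard-≤ h′ h)

hasCard-from : ∀ {n M} {P : Family n → Set} {D : Set} → Fin M ↔ D → (g : D → Family n) →
  (∀ d → P (g d)) → (∀ d d′ → g d ≈F g d′ → d ≡ d′) → (∀ F → P F → ∃ λ d → F ≈F g d) →
  HasCard n P M
hasCard-from {n} {M} {P} E g sound injective complete = v , sound′ , distinct , complete′
  where
  open Inverse E using (to; from; strictlyInverseˡ; strictlyInverseʳ)
  v : Vec (Family n) M
  v = tabulate (g ∘ to)
  lookup-v : ∀ i → lookup v i ≡ g (to i)
  lookup-v = lookup∘tabulate (g ∘ to)
  sound′ : ∀ i → P (lookup v i)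
  sound′ i = subst P (sym (lookup-v i)) (sound (to i))
  distinct : ∀ i j → lookup v i ≈F lookup v j → i ≡ j
  distinct i j e = begin
    i              ≡˘⟨ strictlyInverseʳ i ⟩
    from (to i)    ≡⟨ cong from (injective _ _
                        (≈F-trans (≡⇒≈F (sym (lookup-v i))) (≈F-trans e (≡⇒≈F (lookup-v j))))) ⟩
    from (to j)    ≡⟨ strictlyInverseʳ j ⟩
    j              ∎
    where open ≡-Reasoning
  complete′ : ∀ F → P F → ∃ λ i → F ≈F lookup v i
  complete′ F p with complete F p
  ... | d , F≈gd = from d , ≈F-trans F≈gd
        (≡⇒≈F (trans (cong g (sym (strictlyInverseˡ d))) (sym (lookup-v (from d)))))

module _ {n : ℕ} (Z : ℕ → Set) where

  embed : Σ (Fin n) (Z ∘ suc ∘ toℕ) → Σ ℕ Z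
  embed (j , z) = suc (toℕ j) , z

  embed-injective : ∀ a b → embed a ≡ embed b → a ≡ b
  embed-injective (j , z) (j′ , z′) e =
    same-index j j′ z z′ e (toℕ-injective (ℕ.suc-injective (cong proj₁ e)))
    where
    same-index : ∀ j j′ z z′ → embed (j , z) ≡ embed (j′ , z′) → j ≡ j′ → (j , z) ≡ (j′ , z′)
    same-index j .j z .z refl refl = refl

  embed-onto : ∀ ((k , z) : Σ ℕ Z) → 1 ≤ k → k ≤ n → ∃ λ a → embed a ≡ (k , z)
  embed-onto (suc k , z) _ k<n = hit (fromℕ< k<n) (toℕ-fromℕ< k<n) z
    where
    hit : ∀ j {m} → toℕ j ≡ m → (z : Z (suc m)) → ∃ λ a → embed a ≡ (suc m , z)
    hit j refl z = (j , z) , refl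

-- The classification of zero-dimensional topologies on Fin n

module Classification (n : ℕ) (ZT0 : ℕ → ℕ)
                      (H : ∀ k → HasCard k (ZeroDimT0Top k) (ZT0 k)) where

  listed : ∀ k → Fin (ZT0 k) → Family k
  listed k = lookup (proj₁ (H k))

  listed-zeroDimT0 : ∀ k i → ZeroDimT0Top k (listed k i)
  listed-zeroDimT0 k = proj₁ (proj₂ (H k))

  Labelled : ℕ → Set
  Labelled k = RGS n k × Fin (ZT0 k)

  topology : Σ ℕ Labelled → Family n
  topology (k , r , i) = pull (blockOf r) (listed k i)

  topology-zeroDim : ∀ d → ZeroDimTop n (topology d)
  topology-zeroDim (k , r , i) with listed-zeroDimT0 k i
  ... | top , _ , dim0 = topology-up top , dim0-up dim0
    where open Transfer (blockOf-onto r) (pull-induced (blockOf r) (listed k i))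

  -- The blocks are exactly the indistinguishability classes of the topology,
  -- so equal topologies come from the same partition.
  topology-kernel : ∀ {k} (r : RGS n k) i → HasKernel (blockOf r) (Indist (topology (k , r , i)))
  topology-kernel {k} r i =
    induced-kernel (pull-induced (blockOf r) (listed k i)) (proj₁ (proj₂ (listed-zeroDimT0 k i)))

  same-blocks : ∀ {k k′} (r : RGS n k) (r′ : RGS n k′) i i′ →
    topology (k , r , i) ≈F topology (k′ , r′ , i′) → HasKernel (blockOf r) (λ x y → blockOf r′ x ≡ blockOf r′ y)
  same-blocks r r′ i i′ e x y =
    (λ q → proj₂ (K′ x y) (indist-cong e (proj₁ (K x y) q))) ,
    (λ q → proj₂ (K x y) (indist-cong (≈F-sym e) (proj₁ (K′ x y) q)))
    where
    K : HasKernel (blockOf r) (Indist (topology (_ , r , i)))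
    K = topology-kernel r i
    K′ : HasKernel (blockOf r′) (Indist (topology (_ , r′ , i′)))
    K′ = topology-kernel r′ i′

  topology-injective : ∀ d d′ → topology d ≈F topology d′ → d ≡ d′
  topology-injective (k , r , i) (k′ , r′ , i′) e with rgs-unique r r′ (same-blocks r r′ i i′ e)
  ... | refl = cong (λ i → k , r , i)
    (proj₁ (proj₂ (proj₂ (H k))) i i′ (pull-injective (blockOf-onto r) e))

  from-quotient : ∀ {F k} (r : RGS n k) → HasKernel (blockOf r) (Indist F) → ZeroDimTop n F →
    ∃ λ i → F ≈F topology (k , r , i)
  from-quotient {F} {k} r kernel (top , dim0) =
    i , ≈F-trans (induced≈pull quotient-induced) (pull-cong (blockOf r) quotient≈listed)
    where
    open Quotient (blockOf-onto r) kernel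
    open Transfer (blockOf-onto r) quotient-induced
    listing : ∃ λ i → push (blockOf r) F ≈F listed k i
    listing = proj₂ (proj₂ (proj₂ (H k))) (push (blockOf r) F) (topology-down top , quotient-T0 , dim0-down dim0)
    i : Fin (ZT0 k)
    i = proj₁ listing
    quotient≈listed : push (blockOf r) F ≈F listed k i
    quotient≈listed = proj₂ listing

  topology-onto : ∀ F → ZeroDimTop n F → ∃ λ d → F ≈F topology d
  topology-onto F zeroDim =
    let (k , r , kernel) = rgs-exists (indist-isDecEquivalence F)
        (i , F≈) = from-quotient r kernel zeroDim
    in (k , r , i) , F≈

  zeroDim-count : Fin n →
    HasCard n (ZeroDimTop n) (foldr _+_ 0 (λ (j : Fin n) → S n (suc (toℕ j)) * ZT0 (suc (toℕ j))))
  zeroDim-count x₀ =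
    hasCard-from (enum-Σ _ (λ j → ↔-trans *↔× (enum-RGS n _ ×-↔ ↔-refl)))
                 (topology ∘ embed Labelled) (topology-zeroDim ∘ embed Labelled) injective complete
    where
    injective : ∀ a b → topology (embed Labelled a) ≈F topology (embed Labelled b) → a ≡ b
    injective a b e = embed-injective Labelled a b (topology-injective _ _ e)
    complete : ∀ F → ZeroDimTop n F → ∃ λ a → F ≈F topology (embed Labelled a)
    complete F zeroDim =
      let (d , F≈) = topology-onto F zeroDim
          (_ , r , _) = d
          (a , e) = embed-onto Labelled d (blocks≥1 x₀ r) (blocks≤ r)
      in a , subst (λ d → F ≈F topology d) (sym e) F≈

corollary1 : ∀ (n : ℕ) → n ≥ 1 →
    ∀ (Z : ℕ) → HasCard n (ZeroDimTop n) Z →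
    ∀ (ZT0 : ℕ → ℕ) → (∀ i → HasCard i (ZeroDimT0Top i) (ZT0 i)) →
    Z ≡ sum1to n (λ i → S n i * ZT0 i)
corollary1 n@(suc _) _ Z count ZT0 H = begin
  Z
    ≡⟨ hasCard-unique count (Classification.zeroDim-count n ZT0 H zero) ⟩
  foldr _+_ 0 (λ (j : Fin n) → S n (suc (toℕ j)) * ZT0 (suc (toℕ j)))
    ≡˘⟨ sum-applyUpTo n suc (λ i → S n i * ZT0 i) ⟩
  sum1to n (λ i → S n i * ZT0 i)
    ∎
  where open ≡-Reasoning
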